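{- Let $m\ge1$ and let $\mathbf a=(a_0,\dots,a_m)$ be a palindrome, i.e. $a_i=a_{m-i}$ for all $i=0,\dots,m$. Then for every integer $k\ge0$, $$\sum_{n=0}^{mk}\binom{k}{n}_{\mathbf a}^{2}=\binom{2k}{mk}_{\mathbf a}.$$
   Context: For $\mathbf a=(a_0,\dots,a_m)$ let $p_{\mathbf a}(t)=\sum_{i=0}^m a_i t^i$. The polynomial coefficients are defined, for integers $k\ge 0$ and $n$, by $\binom{k}{n}_{\mathbf a}=[t^n]\,p_{\mathbf a}(t)^k$ if $0\le n\le mk$, and $0$ if $n<0$ or $n>mk$, where $[t^n]F(t)$ is the coefficient of $t^n$ in $F$. -}

module Defs where

open import Data.Nat using (ℕ; zero; suc; _∸_; _≤_; _*_)
open import Data.Integer using (ℤ; 0ℤ; 1ℤ) renaming (_+_ to _+ℤ_; _*_ to _*ℤ_)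
open import Data.Fin using (Fin; toℕ)
open import Data.List using (List; []; _∷_; map)
open import Data.Vec.Functional using (Vector)
import Data.Nat
import Relation.Binary.PropositionalEquality

-- Polynomials with integer coefficients, as coefficient lists
-- (lowest degree first); p = a₀ ∷ a₁ ∷ … represents a₀ + a₁ t + …
Poly : Set
Poly = List ℤ

_⊕_ : Poly → Poly → Poly
[] ⊕ q = q
(x ∷ p) ⊕ [] = x ∷ p
(x ∷ p) ⊕ (y ∷ q) = (x +ℤ y) ∷ (p ⊕ q)

-- multiplication: (x + t p) q = x q + t (p q)
_⊗_ : Poly → Poly → Poly
[] ⊗ q = []
(x ∷ p) ⊗ q = map (x *ℤ_) q ⊕ (0ℤ ∷ (p ⊗ q))

_^ᴾ_ : Poly → ℕ → Poly
p ^ᴾ zero = 1ℤ ∷ []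
p ^ᴾ suc k = p ⊗ (p ^ᴾ k)

coeff : ℕ → Poly → ℤ
coeff n [] = 0ℤ
coeff zero (x ∷ p) = x
coeff (suc n) (x ∷ p) = coeff n p

polyOf : (m : ℕ) → Vector ℤ (suc m) → Poly
polyOf m a = map (λ i → a i) (Data.List.allFin (suc m))

-- the polynomial coefficient  binom(k, n)_a  for n ≥ 0; it is
-- [tⁿ] p_a(t)^k, which is automatically 0 when n > m k
-- (the case n < 0 never arises in the statement)
polyCoeff : (m : ℕ) → Vector ℤ (suc m) → ℕ → ℕ → ℤ
polyCoeff m a k n = coeff n (polyOf m a ^ᴾ k)

Palindrome : (m : ℕ) → Vector ℤ (suc m) → Set
Palindrome m a = (i j : Fin (suc m)) → toℕ i Data.Nat.+ toℕ j Relation.Binary.PropositionalEquality.≡ m → a i Relation.Binary.PropositionalEquality.≡ a j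

sumTo : ℕ → (ℕ → ℤ) → ℤ
sumTo zero f = f 0
sumTo (suc N) f = sumTo N f +ℤ f (suc N)

-- Write P = p_a(t) and c_n = [tⁿ] Pᵏ.  A polynomial of degree ≤ d is
-- d-palindromic when [tⁱ] P = [t^(d-i)] P for all integers i (with
-- coefficients at negative indices read as 0, so this also forces the
-- coefficients beyond d to vanish).  The argument is:
--   1. coefficient lists form a ring up to coefficientwise equality; in
--      particular P^(j+k) ≈ P^j ⊗ P^k, and [t^N](P ⊗ Q) is the
--      convolution Σ_{i≤N} [tⁱ]P · [t^(N-i)]Q;
--   2. a product of a d-palindrome and an e-palindrome is a
--      (d+e)-palindrome, hence Pᵏ is an mk-palindrome when a is a
--      palindrome of length m+1;
--   3. therefore Σ_n c_n² = Σ_n c_n c_(mk-n) = [t^(mk)] (Pᵏ ⊗ Pᵏ)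
--      = [t^(mk)] P^(2k).
module Submission where

open import Defs
open import Data.Nat using (ℕ; suc; _≤_; _*_)
open import Data.Integer using (ℤ) renaming (_*_ to _*ℤ_)
open import Data.Vec.Functional using (Vector)
open import Relation.Binary.PropositionalEquality using (_≡_)

import Data.Nat as N
open import Data.Nat using (zero)
import Data.Nat.Properties as NP
open import Data.Integer using (+_; -[1+_]; 0ℤ; 1ℤ; _-_; _⊖_) renaming (_+_ to _+ℤ_)
import Data.Integer.Properties as ZP
open import Data.Integer.Tactic.RingSolver using (solve-∀)
open import Data.List using ([]; _∷_; map; tabulate)
import Data.List.Properties as LP
open import Data.Fin using (Fin; toℕ; fromℕ<) renaming (zero to fz; suc to fs)
import Data.Fin.Properties as FP
open import Data.Sum using (inj₁; inj₂)
open import Relation.Nullary using (yes; no)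
open import Relation.Binary.PropositionalEquality using (refl; sym; trans; cong; cong₂; subst; module ≡-Reasoning)
open ≡-Reasoning

-- Two coefficient lists are equal as polynomials when all their
-- coefficients agree (trailing zeros do not matter).
_≈_ : Poly → Poly → Set
P ≈ Q = ∀ n → coeff n P ≡ coeff n Q

coeff-⊕ : ∀ P Q n → coeff n (P ⊕ Q) ≡ coeff n P +ℤ coeff n Q
coeff-⊕ [] Q n = sym (ZP.+-identityˡ _)
coeff-⊕ (x ∷ P) [] n = sym (ZP.+-identityʳ _)
coeff-⊕ (x ∷ P) (y ∷ Q) zero = refl
coeff-⊕ (x ∷ P) (y ∷ Q) (suc n) = coeff-⊕ P Q n

coeff-scale : ∀ x Q n → coeff n (map (x *ℤ_) Q) ≡ x *ℤ coeff n Q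
coeff-scale x [] n = sym (ZP.*-zeroʳ x)
coeff-scale x (y ∷ Q) zero = refl
coeff-scale x (y ∷ Q) (suc n) = coeff-scale x Q n

shift-cong : ∀ {R S} → R ≈ S → (0ℤ ∷ R) ≈ (0ℤ ∷ S)
shift-cong e zero = refl
shift-cong e (suc n) = e n

coeff-shift-scale : ∀ x R n → coeff n (0ℤ ∷ map (x *ℤ_) R) ≡ x *ℤ coeff n (0ℤ ∷ R)
coeff-shift-scale x R zero = sym (ZP.*-zeroʳ x)
coeff-shift-scale x R (suc n) = coeff-scale x R n

coeff-⊗ : ∀ x P Q n → coeff n ((x ∷ P) ⊗ Q) ≡ x *ℤ coeff n Q +ℤ coeff n (0ℤ ∷ (P ⊗ Q))
coeff-⊗ x P Q n = trans (coeff-⊕ (map (x *ℤ_) Q) (0ℤ ∷ (P ⊗ Q)) n)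
  (cong (_+ℤ coeff n (0ℤ ∷ (P ⊗ Q))) (coeff-scale x Q n))

⊗-congʳ : ∀ P {Q Q'} → Q ≈ Q' → (P ⊗ Q) ≈ (P ⊗ Q')
⊗-congʳ [] e n = refl
⊗-congʳ (x ∷ P) {Q} {Q'} e n = begin
  coeff n ((x ∷ P) ⊗ Q)                     ≡⟨ coeff-⊗ x P Q n ⟩
  x *ℤ coeff n Q +ℤ coeff n (0ℤ ∷ (P ⊗ Q))   ≡⟨ cong₂ (λ u v → x *ℤ u +ℤ v) (e n) (shift-cong (⊗-congʳ P e) n) ⟩
  x *ℤ coeff n Q' +ℤ coeff n (0ℤ ∷ (P ⊗ Q')) ≡⟨ sym (coeff-⊗ x P Q' n) ⟩
  coeff n ((x ∷ P) ⊗ Q')                    ∎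

⊗-distribʳ-⊕ : ∀ A B R → ((A ⊕ B) ⊗ R) ≈ ((A ⊗ R) ⊕ (B ⊗ R))
⊗-distribʳ-⊕ [] B R n = refl
⊗-distribʳ-⊕ (x ∷ A) [] R n = sym (trans (coeff-⊕ ((x ∷ A) ⊗ R) [] n) (ZP.+-identityʳ _))
⊗-distribʳ-⊕ (x ∷ A) (y ∷ B) R n = begin
  coeff n (((x +ℤ y) ∷ (A ⊕ B)) ⊗ R)                ≡⟨ coeff-⊗ (x +ℤ y) (A ⊕ B) R n ⟩
  (x +ℤ y) *ℤ r +ℤ coeff n (0ℤ ∷ ((A ⊕ B) ⊗ R))      ≡⟨ cong ((x +ℤ y) *ℤ r +ℤ_) shifted-sum ⟩
  (x +ℤ y) *ℤ r +ℤ (a +ℤ b)                          ≡⟨ regroup x y r a b ⟩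
  (x *ℤ r +ℤ a) +ℤ (y *ℤ r +ℤ b)                     ≡⟨ sym (cong₂ _+ℤ_ (coeff-⊗ x A R n) (coeff-⊗ y B R n)) ⟩
  coeff n ((x ∷ A) ⊗ R) +ℤ coeff n ((y ∷ B) ⊗ R)     ≡⟨ sym (coeff-⊕ ((x ∷ A) ⊗ R) ((y ∷ B) ⊗ R) n) ⟩
  coeff n (((x ∷ A) ⊗ R) ⊕ ((y ∷ B) ⊗ R))            ∎
  where
  r a b : ℤ
  r = coeff n R
  a = coeff n (0ℤ ∷ (A ⊗ R))
  b = coeff n (0ℤ ∷ (B ⊗ R))
  -- 0 ∷ (U ⊕ V) is literally (0 ∷ U) ⊕ (0 ∷ V), since 0 + 0 reduces to 0
  shifted-sum : coeff n (0ℤ ∷ ((A ⊕ B) ⊗ R)) ≡ a +ℤ b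
  shifted-sum = trans (shift-cong (⊗-distribʳ-⊕ A B R) n)
                      (coeff-⊕ (0ℤ ∷ (A ⊗ R)) (0ℤ ∷ (B ⊗ R)) n)
  regroup : ∀ x y r a b → (x +ℤ y) *ℤ r +ℤ (a +ℤ b) ≡ (x *ℤ r +ℤ a) +ℤ (y *ℤ r +ℤ b)
  regroup = solve-∀

⊗-scaleˡ : ∀ x Q R → (map (x *ℤ_) Q ⊗ R) ≈ map (x *ℤ_) (Q ⊗ R)
⊗-scaleˡ x [] R n = refl
⊗-scaleˡ x (y ∷ Q) R n = begin
  coeff n ((x *ℤ y ∷ map (x *ℤ_) Q) ⊗ R)                 ≡⟨ coeff-⊗ (x *ℤ y) (map (x *ℤ_) Q) R n ⟩
  x *ℤ y *ℤ r +ℤ coeff n (0ℤ ∷ (map (x *ℤ_) Q ⊗ R))       ≡⟨ cong (x *ℤ y *ℤ r +ℤ_) shifted-scale ⟩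
  x *ℤ y *ℤ r +ℤ x *ℤ s                                  ≡⟨ factor x y r s ⟩
  x *ℤ (y *ℤ r +ℤ s)                                     ≡⟨ cong (x *ℤ_) (sym (coeff-⊗ y Q R n)) ⟩
  x *ℤ coeff n ((y ∷ Q) ⊗ R)                             ≡⟨ sym (coeff-scale x ((y ∷ Q) ⊗ R) n) ⟩
  coeff n (map (x *ℤ_) ((y ∷ Q) ⊗ R))                    ∎
  where
  r s : ℤ
  r = coeff n R
  s = coeff n (0ℤ ∷ (Q ⊗ R))
  shifted-scale : coeff n (0ℤ ∷ (map (x *ℤ_) Q ⊗ R)) ≡ x *ℤ s
  shifted-scale = trans (shift-cong (⊗-scaleˡ x Q R) n) (coeff-shift-scale x (Q ⊗ R) n)
  factor : ∀ x y r s → x *ℤ y *ℤ r +ℤ x *ℤ s ≡ x *ℤ (y *ℤ r +ℤ s)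
  factor = solve-∀

coeff-shift-⊗ : ∀ S R n → coeff n ((0ℤ ∷ S) ⊗ R) ≡ coeff n (0ℤ ∷ (S ⊗ R))
coeff-shift-⊗ S R n = trans (coeff-⊗ 0ℤ S R n) (ZP.+-identityˡ _)

⊗-assoc : ∀ P Q R → (P ⊗ (Q ⊗ R)) ≈ ((P ⊗ Q) ⊗ R)
⊗-assoc [] Q R n = refl
⊗-assoc (x ∷ P) Q R n = begin
  coeff n ((x ∷ P) ⊗ (Q ⊗ R))                                  ≡⟨ coeff-⊗ x P (Q ⊗ R) n ⟩
  x *ℤ coeff n (Q ⊗ R) +ℤ coeff n (0ℤ ∷ (P ⊗ (Q ⊗ R)))          ≡⟨ cong₂ _+ℤ_ (sym (coeff-scale x (Q ⊗ R) n)) (shift-cong (⊗-assoc P Q R) n) ⟩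
  coeff n (map (x *ℤ_) (Q ⊗ R)) +ℤ coeff n (0ℤ ∷ ((P ⊗ Q) ⊗ R)) ≡⟨ cong₂ _+ℤ_ (sym (⊗-scaleˡ x Q R n)) (sym (coeff-shift-⊗ (P ⊗ Q) R n)) ⟩
  coeff n (map (x *ℤ_) Q ⊗ R) +ℤ coeff n ((0ℤ ∷ (P ⊗ Q)) ⊗ R)   ≡⟨ sym (coeff-⊕ (map (x *ℤ_) Q ⊗ R) ((0ℤ ∷ (P ⊗ Q)) ⊗ R) n) ⟩
  coeff n ((map (x *ℤ_) Q ⊗ R) ⊕ ((0ℤ ∷ (P ⊗ Q)) ⊗ R))          ≡⟨ sym (⊗-distribʳ-⊕ (map (x *ℤ_) Q) (0ℤ ∷ (P ⊗ Q)) R n) ⟩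
  coeff n (((x ∷ P) ⊗ Q) ⊗ R)                                  ∎

⊗-identityˡ : ∀ R → ((1ℤ ∷ []) ⊗ R) ≈ R
⊗-identityˡ R n = begin
  coeff n ((1ℤ ∷ []) ⊗ R)               ≡⟨ coeff-⊗ 1ℤ [] R n ⟩
  1ℤ *ℤ coeff n R +ℤ coeff n (0ℤ ∷ [])  ≡⟨ cong₂ _+ℤ_ (ZP.*-identityˡ (coeff n R)) (coeff-t0 n) ⟩
  coeff n R +ℤ 0ℤ                       ≡⟨ ZP.+-identityʳ _ ⟩
  coeff n R                             ∎
  where
  coeff-t0 : ∀ n → coeff n (0ℤ ∷ []) ≡ 0ℤ
  coeff-t0 zero = refl
  coeff-t0 (suc n) = refl

^ᴾ-+ : ∀ P j k → (P ^ᴾ (j N.+ k)) ≈ ((P ^ᴾ j) ⊗ (P ^ᴾ k))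
^ᴾ-+ P zero k n = sym (⊗-identityˡ (P ^ᴾ k) n)
^ᴾ-+ P (suc j) k n = trans (⊗-congʳ P (^ᴾ-+ P j k) n) (⊗-assoc P (P ^ᴾ j) (P ^ᴾ k) n)

sumTo-front : ∀ N g → sumTo (suc N) g ≡ g 0 +ℤ sumTo N (λ i → g (suc i))
sumTo-front zero g = refl
sumTo-front (suc N) g = trans (cong (_+ℤ g (suc (suc N))) (sumTo-front N g))
  (ZP.+-assoc (g 0) (sumTo N (λ i → g (suc i))) (g (suc (suc N))))

sumTo-cong : ∀ N {f g} → (∀ i → i N.≤ N → f i ≡ g i) → sumTo N f ≡ sumTo N g
sumTo-cong zero e = e 0 N.z≤n
sumTo-cong (suc N) e = cong₂ _+ℤ_ (sumTo-cong N (λ i le → e i (NP.m≤n⇒m≤1+n le))) (e (suc N) NP.≤-refl)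

sumTo-zero : ∀ N f → (∀ i → f i ≡ 0ℤ) → sumTo N f ≡ 0ℤ
sumTo-zero zero f e = e 0
sumTo-zero (suc N) f e = cong₂ _+ℤ_ (sumTo-zero N f e) (e (suc N))

sumTo-truncate : ∀ N M g → N N.≤ M → (∀ i → N N.< i → g i ≡ 0ℤ) → sumTo M g ≡ sumTo N g
sumTo-truncate N zero g N.z≤n vanish = refl
sumTo-truncate N (suc M) g le vanish with NP.m≤n⇒m<n∨m≡n le
... | inj₂ refl = refl
... | inj₁ lt = trans (cong₂ _+ℤ_ (sumTo-truncate N M g (N.s≤s⁻¹ lt) vanish) (vanish (suc M) lt))
                      (ZP.+-identityʳ _)

sumTo-reflect : ∀ N g → sumTo N g ≡ sumTo N (λ i → g (N N.∸ i))
sumTo-reflect zero g = refl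
sumTo-reflect (suc N) g = begin
  sumTo N g +ℤ g (suc N)                     ≡⟨ ZP.+-comm (sumTo N g) (g (suc N)) ⟩
  g (suc N) +ℤ sumTo N g                     ≡⟨ cong (g (suc N) +ℤ_) (sumTo-reflect N g) ⟩
  g (suc N) +ℤ sumTo N (λ i → g (N N.∸ i))   ≡⟨ sym (sumTo-front N (λ i → g (suc N N.∸ i))) ⟩
  sumTo (suc N) (λ i → g (suc N N.∸ i))      ∎

coeff-conv : ∀ P Q N → coeff N (P ⊗ Q) ≡ sumTo N (λ i → coeff i P *ℤ coeff (N N.∸ i) Q)
coeff-conv [] Q N = sym (sumTo-zero N _ (λ i → refl))
coeff-conv (x ∷ P) Q zero = trans (coeff-⊗ x P Q 0) (ZP.+-identityʳ _)
coeff-conv (x ∷ P) Q (suc N) = trans (coeff-⊗ x P Q (suc N))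
  (trans (cong (x *ℤ coeff (suc N) Q +ℤ_) (coeff-conv P Q N))
    (sym (sumTo-front N (λ i → coeff i (x ∷ P) *ℤ coeff (suc N N.∸ i) Q))))

coeffℤ : ℤ → Poly → ℤ
coeffℤ (+ n) P = coeff n P
coeffℤ -[1+ n ] P = 0ℤ

-- P is a d-palindrome: [tᶻ]P = [t^(d-z)]P for every integer z.  Taking
-- z < 0 shows that P has degree at most d.
Pal : ℕ → Poly → Set
Pal d P = ∀ z → coeffℤ z P ≡ coeffℤ (+ d - z) P

DegreeAtMost : ℕ → Poly → Set
DegreeAtMost d P = ∀ i → d N.< i → coeff i P ≡ 0ℤ

+-∸ : ∀ N i → i N.≤ N → + (N N.∸ i) ≡ + N - + i
+-∸ N i le = trans (sym (ZP.⊖-≥ le)) (sym (ZP.m-n≡m⊖n N i))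

coeffℤ-negative : ∀ P d i → d N.< i → coeffℤ (+ d - + i) P ≡ 0ℤ
coeffℤ-negative P d i lt = trans (cong (λ z → coeffℤ z P) (ZP.m-n≡m⊖n d i)) (go d i lt)
  where
  go : ∀ d i → d N.< i → coeffℤ (d ⊖ i) P ≡ 0ℤ
  go zero (suc i) lt = refl
  go (suc d) (suc i) lt = trans (cong (λ z → coeffℤ z P) (ZP.[1+m]⊖[1+n]≡m⊖n d i)) (go d i (N.s<s⁻¹ lt))

Pal⇒degree : ∀ {d P} → Pal d P → DegreeAtMost d P
Pal⇒degree {d} {P} pal i lt = trans (pal (+ i)) (coeffℤ-negative P d i lt)

Pal-mirror : ∀ {d P} → Pal d P → ∀ i → i N.≤ d → coeff i P ≡ coeff (d N.∸ i) P
Pal-mirror {d} {P} pal i le = trans (pal (+ i)) (cong (λ z → coeffℤ z P) (sym (+-∸ d i le)))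

Pal-intro : ∀ d P → DegreeAtMost d P → (∀ i → i N.≤ d → coeff i P ≡ coeff (d N.∸ i) P) → Pal d P
Pal-intro d P deg mirror -[1+ n ] = sym (deg (d N.+ suc n) (NP.m<m+n d (N.s≤s N.z≤n)))
Pal-intro d P deg mirror (+ n) with n N.≤? d
... | yes le = trans (mirror n le) (cong (λ z → coeffℤ z P) (+-∸ d n le))
... | no n≰d = trans (deg n (NP.≰⇒> n≰d)) (sym (coeffℤ-negative P d n (NP.≰⇒> n≰d)))

coeffℤ-⊗ : ∀ {d} P Q → DegreeAtMost d P → ∀ z →
           coeffℤ z (P ⊗ Q) ≡ sumTo d (λ i → coeff i P *ℤ coeffℤ (z - + i) Q)
coeffℤ-⊗ {d} P Q deg -[1+ n ] =
  sym (sumTo-zero d _ (λ i → trans (cong (coeff i P *ℤ_) (below-zero i)) (ZP.*-zeroʳ (coeff i P))))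
  where
  below-zero : ∀ i → coeffℤ (-[1+ n ] - + i) Q ≡ 0ℤ
  below-zero zero = refl
  below-zero (suc i) = refl
coeffℤ-⊗ {d} P Q deg (+ N) = begin
  coeff N (P ⊗ Q)                                 ≡⟨ coeff-conv P Q N ⟩
  sumTo N (λ i → coeff i P *ℤ coeff (N N.∸ i) Q)  ≡⟨ sumTo-cong N (λ i le → cong (λ z → coeff i P *ℤ coeffℤ z Q) (+-∸ N i le)) ⟩
  sumTo N h                                       ≡⟨ sym (sumTo-truncate N (N N.+ d) h (NP.m≤m+n N d) vanish-beyond-N) ⟩
  sumTo (N N.+ d) h                               ≡⟨ cong (λ M → sumTo M h) (NP.+-comm N d) ⟩
  sumTo (d N.+ N) h                               ≡⟨ sumTo-truncate d (d N.+ N) h (NP.m≤m+n d N) vanish-beyond-d ⟩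
  sumTo d h                                       ∎
  where
  h : ℕ → ℤ
  h i = coeff i P *ℤ coeffℤ (+ N - + i) Q
  vanish-beyond-N : ∀ i → N N.< i → h i ≡ 0ℤ
  vanish-beyond-N i lt = trans (cong (coeff i P *ℤ_) (coeffℤ-negative Q N i lt)) (ZP.*-zeroʳ (coeff i P))
  vanish-beyond-d : ∀ i → d N.< i → h i ≡ 0ℤ
  vanish-beyond-d i lt = trans (cong (_*ℤ coeffℤ (+ N - + i) Q) (deg i lt)) (ZP.*-zeroˡ (coeffℤ (+ N - + i) Q))

-- A product of a d-palindrome and an e-palindrome is a (d+e)-palindrome:
-- reflect the convolution sum, then mirror both factors.
Pal-⊗ : ∀ {d e P Q} → Pal d P → Pal e Q → Pal (d N.+ e) (P ⊗ Q)
Pal-⊗ {d} {e} {P} {Q} pP pQ z = begin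
  coeffℤ z (P ⊗ Q)                                                ≡⟨ coeffℤ-⊗ P Q deg z ⟩
  sumTo d (λ i → coeff i P *ℤ coeffℤ (z - + i) Q)                  ≡⟨ sumTo-cong d mirror-term ⟩
  sumTo d (λ i → coeff (d N.∸ i) P *ℤ coeffℤ (w - + (d N.∸ i)) Q)  ≡⟨ sym (sumTo-reflect d (λ i → coeff i P *ℤ coeffℤ (w - + i) Q)) ⟩
  sumTo d (λ i → coeff i P *ℤ coeffℤ (w - + i) Q)                  ≡⟨ sym (coeffℤ-⊗ P Q deg w) ⟩
  coeffℤ w (P ⊗ Q)                                                ∎
  where
  deg : DegreeAtMost d P
  deg = Pal⇒degree pP
  w : ℤ
  w = + (d N.+ e) - z
  index-identity : ∀ (d e z i : ℤ) → (d +ℤ e) - z - (d - i) ≡ e - (z - i)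
  index-identity = solve-∀
  mirror-index : ∀ i → i N.≤ d → + e - (z - + i) ≡ w - + (d N.∸ i)
  mirror-index i le = sym (trans (cong₂ (λ u v → u - z - v) (ZP.pos-+ d e) (+-∸ d i le))
                                 (index-identity (+ d) (+ e) z (+ i)))
  mirror-term : ∀ i → i N.≤ d → coeff i P *ℤ coeffℤ (z - + i) Q ≡ coeff (d N.∸ i) P *ℤ coeffℤ (w - + (d N.∸ i)) Q
  mirror-term i le = cong₂ _*ℤ_ (Pal-mirror pP i le)
                                (trans (pQ (z - + i)) (cong (λ u → coeffℤ u Q) (mirror-index i le)))

Pal-one : Pal 0 (1ℤ ∷ [])
Pal-one (+ zero) = refl
Pal-one (+ suc n) = refl
Pal-one -[1+ n ] = refl

Pal-^ : ∀ {d P} → Pal d P → ∀ k → Pal (d * k) (P ^ᴾ k)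
Pal-^ {d} pP zero = subst (λ e → Pal e (1ℤ ∷ [])) (sym (NP.*-zeroʳ d)) Pal-one
Pal-^ {d} {P} pP (suc k) = subst (λ e → Pal e (P ⊗ (P ^ᴾ k))) (sym (NP.*-suc d k)) (Pal-⊗ pP (Pal-^ pP k))

coeff-tabulate-out : ∀ {n} (f : Fin n → ℤ) i → n N.≤ i → coeff i (tabulate f) ≡ 0ℤ
coeff-tabulate-out {zero} f i le = refl
coeff-tabulate-out {suc n} f (suc i) le = coeff-tabulate-out (λ x → f (fs x)) i (N.s≤s⁻¹ le)

coeff-tabulate-in : ∀ {n} (f : Fin n → ℤ) i (lt : i N.< n) → coeff i (tabulate f) ≡ f (fromℕ< lt)
coeff-tabulate-in f i lt = trans (cong (λ j → coeff j (tabulate f)) (sym (FP.toℕ-fromℕ< lt))) (at-toℕ f (fromℕ< lt))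
  where
  at-toℕ : ∀ {n} (f : Fin n → ℤ) (j : Fin n) → coeff (toℕ j) (tabulate f) ≡ f j
  at-toℕ f fz = refl
  at-toℕ f (fs j) = at-toℕ (λ x → f (fs x)) j

Pal-polyOf : ∀ m (a : Vector ℤ (suc m)) → Palindrome m a → Pal m (polyOf m a)
Pal-polyOf m a pa = subst (Pal m) (sym (LP.map-tabulate (λ i → i) a))
  (Pal-intro m (tabulate a) (λ i → coeff-tabulate-out a i) mirror)
  where
  mirror : ∀ i → i N.≤ m → coeff i (tabulate a) ≡ coeff (m N.∸ i) (tabulate a)
  mirror i le = begin
    coeff i (tabulate a)          ≡⟨ coeff-tabulate-in a i (N.s≤s le) ⟩
    a (fromℕ< (N.s≤s le))         ≡⟨ pa _ _ indices-sum-to-m ⟩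
    a (fromℕ< m-i<1+m)            ≡⟨ sym (coeff-tabulate-in a (m N.∸ i) m-i<1+m) ⟩
    coeff (m N.∸ i) (tabulate a)  ∎
    where
    m-i<1+m : m N.∸ i N.< suc m
    m-i<1+m = N.s≤s (NP.m∸n≤m m i)
    indices-sum-to-m : toℕ (fromℕ< (N.s≤s le)) N.+ toℕ (fromℕ< m-i<1+m) ≡ m
    indices-sum-to-m = trans (cong₂ N._+_ (FP.toℕ-fromℕ< (N.s≤s le)) (FP.toℕ-fromℕ< m-i<1+m))
                             (NP.m+[n∸m]≡n le)

-- Σ_n c_n² = Σ_n c_n c_(mk-n) = [t^(mk)](Pᵏ Pᵏ) = [t^(mk)] P^(2k), the first
-- step by mirror symmetry of the mk-palindrome Pᵏ.
mainTheorem10 : (m : ℕ) → 1 ≤ m → (a : Vector ℤ (suc m)) → Palindrome m a →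
    (k : ℕ) →
    sumTo (m * k) (λ n → polyCoeff m a k n *ℤ polyCoeff m a k n)
    ≡ polyCoeff m a (2 * k) (m * k)
mainTheorem10 m _ a pa k = begin
  sumTo N (λ n → c n *ℤ c n)            ≡⟨ sumTo-cong N (λ i le → cong (c i *ℤ_) (Pal-mirror palPk i le)) ⟩
  sumTo N (λ i → c i *ℤ c (N N.∸ i))    ≡⟨ sym (coeff-conv Pk Pk N) ⟩
  coeff N (Pk ⊗ Pk)                     ≡⟨ cong (λ j → coeff N (Pk ⊗ (P ^ᴾ j))) (sym (NP.*-identityˡ k)) ⟩
  coeff N (Pk ⊗ (P ^ᴾ (1 * k)))         ≡⟨ sym (^ᴾ-+ P k (1 * k) N) ⟩
  coeff N (P ^ᴾ (2 * k))                ∎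
  where
  P : Poly
  P = polyOf m a
  Pk : Poly
  Pk = P ^ᴾ k
  N : ℕ
  N = m * k
  c : ℕ → ℤ
  c n = coeff n Pk
  palPk : Pal N Pk
  palPk = Pal-^ (Pal-polyOf m a pa) k
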